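{- Let $\mathfrak S,\mathfrak S'$ be categories. (i) Let $F:\mathfrak S\to\mathfrak S'$ be a full functor which is cofinal (for every $\mathfrak S'$-object $x$ there are an $\mathfrak S$-object $y$ and an $\mathfrak S'$-arrow $x\to F(y)$). If $\alpha:a\to a'$ is a Ramsey arrow in $\mathfrak S$, then $F(\alpha)$ is a Ramsey arrow in $\mathfrak S'$. (ii) Let $\mathfrak S\subseteq\mathfrak S'$ be a full cofinal subcategory (every $\mathfrak S'$-object has an $\mathfrak S'$-arrow into an $\mathfrak S$-object). An $\mathfrak S$-arrow $\alpha$ is Ramsey in $\mathfrak S$ if and only if it is Ramsey in $\mathfrak S'$.
   Context: Categories are locally small, composition $g\circ f$ ($f$ first), $\mathfrak C(a,b)$ the set of arrows $a\to b$, and $\mathfrak C(\alpha,b):=\{f\circ\alpha:f\in\mathfrak C(a',b)\}$ for $\alpha:a\to a'$. An arrow $\alpha:a\to a'$ in $\mathfrak C$ is a Ramsey arrow if for every object $b$, every $k\in\mathbb N$ and every finite $F\subseteq\mathfrak C(\alpha,b)$ there is an object $v$ such that for every map $\phi:\mathfrak C(\alpha,v)\to k$ there is $e\in\mathfrak C(b,v)$ with $\phi$ constant on $e\circ F=\{e\circ f:f\in F\}$. -}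

module Defs where

open import Level using (Level; _⊔_; suc)
open import Data.Nat using (ℕ)
open import Data.Fin using (Fin)
open import Data.List using (List)
open import Data.List.Membership.Propositional using (_∈_)
open import Data.Product using (Σ; ∃; _,_; proj₁; proj₂)
open import Relation.Binary.PropositionalEquality using (_≡_; cong; trans; sym)

-- A (locally small) category; hom-sets are types, equality of arrows is ≡.
-- Composition g ∘ f means "f first".
record Category (o ℓ : Level) : Set (Level.suc (o ⊔ ℓ)) where
  infixr 9 _∘_
  field
    Obj   : Set o
    Hom   : Obj → Obj → Set ℓ
    id    : ∀ {a} → Hom a a
    _∘_   : ∀ {a b c} → Hom b c → Hom a b → Hom a c
    assoc : ∀ {a b c d} {f : Hom a b} {g : Hom b c} {h : Hom c d} →
            (h ∘ g) ∘ f ≡ h ∘ (g ∘ f)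
    identityˡ : ∀ {a b} {f : Hom a b} → id ∘ f ≡ f
    identityʳ : ∀ {a b} {f : Hom a b} → f ∘ id ≡ f

module _ {o ℓ} (C : Category o ℓ) where
  open Category C

  InImage : ∀ {a a' b} → Hom a a' → Hom a b → Set ℓ
  InImage {a' = a'} {b} α f = Σ (Hom a' b) λ g → f ≡ g ∘ α

  HomFrom : ∀ {a a'} → Hom a a' → Obj → Set ℓ
  HomFrom {a} α b = Σ (Hom a b) (InImage α)

  postIm : ∀ {a a' b v} {α : Hom a a'} (e : Hom b v) {f : Hom a b} →
           InImage α f → InImage α (e ∘ f)
  postIm e (g , p) = (e ∘ g) , trans (cong (e ∘_) p) (sym assoc)

  -- a map φ : 𝔊(α, v) → k  (the membership proof is irrelevant, so φ is a
  -- function of the arrow alone)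
  Colouring : ∀ {a a'} → Hom a a' → Obj → ℕ → Set ℓ
  Colouring {a} α v k = (f : Hom a v) → .(InImage α f) → Fin k

  ConstantOn : ∀ {a a' b v k} {α : Hom a a'} →
               Colouring α v k → Hom b v → List (HomFrom α b) → Set ℓ
  ConstantOn φ e F =
    ∀ {u w} → u ∈ F → w ∈ F →
      φ (e ∘ proj₁ u) (postIm e (proj₂ u)) ≡ φ (e ∘ proj₁ w) (postIm e (proj₂ w))

  -- Ramsey arrow; finite subsets F ⊆ 𝔊(α, b) are given by finite lists
  IsRamsey : ∀ {a a'} → Hom a a' → Set (o ⊔ ℓ)
  IsRamsey α = ∀ b (k : ℕ) (F : List (HomFrom α b)) →
    ∃ λ v → (φ : Colouring α v k) → ∃ λ (e : Hom b v) → ConstantOn φ e F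

record Functor {o ℓ o' ℓ'} (C : Category o ℓ) (D : Category o' ℓ')
       : Set (o ⊔ ℓ ⊔ o' ⊔ ℓ') where
  private
    module C = Category C
    module D = Category D
  field
    F₀ : C.Obj → D.Obj
    F₁ : ∀ {a b} → C.Hom a b → D.Hom (F₀ a) (F₀ b)
    F-id : ∀ {a} → F₁ (C.id {a}) ≡ D.id
    F-∘  : ∀ {a b c} {f : C.Hom a b} {g : C.Hom b c} →
           F₁ (g C.∘ f) ≡ F₁ g D.∘ F₁ f

module _ {o ℓ o' ℓ'} {C : Category o ℓ} {D : Category o' ℓ'} where
  private
    module C = Category C
    module D = Category D
  open Functor

  Full : Functor C D → Set (o ⊔ ℓ ⊔ ℓ')
  Full F = ∀ {x y} (h : D.Hom (F₀ F x) (F₀ F y)) → ∃ λ f → F₁ F f ≡ h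

  Cofinal : Functor C D → Set (o ⊔ o' ⊔ ℓ')
  Cofinal F = ∀ (x : D.Obj) → ∃ λ (y : C.Obj) → D.Hom x (F₀ F y)

FullSub : ∀ {o ℓ p} (C : Category o ℓ) → (Category.Obj C → Set p) →
          Category (o ⊔ p) ℓ
FullSub C P = record
  { Obj = Σ Obj P
  ; Hom = λ x y → Hom (proj₁ x) (proj₁ y)
  ; id = id
  ; _∘_ = _∘_
  ; assoc = assoc
  ; identityˡ = identityˡ
  ; identityʳ = identityʳ
  }
  where open Category C

CofinalSub : ∀ {o ℓ p} (C : Category o ℓ) → (Category.Obj C → Set p) →
             Set (o ⊔ ℓ ⊔ p)
CofinalSub C P = ∀ x → ∃ λ y → P y × Category.Hom C x y
  where open import Data.Product using (_×_)

-- (i) Given b, cofinality gives c : b → F y, and fullness rewrites each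
-- g ∘ F α in the finite family as F g' ∘ F α with F g' = c ∘ g; this yields a
-- finite family in 𝔖(α, y). A colouring of 𝔖'(F α, F v) restricts along F to
-- one of 𝔖(α, v), and a witness e : y → v in 𝔖 gives the witness F e ∘ c.
-- (ii) "Ramsey in 𝔖 ⇒ Ramsey in 𝔖'" is (i) for the inclusion. Conversely, push
-- the 𝔖'-witness object v into the subcategory along some c : v → w and
-- precompose colourings of 𝔖(α, w) with c.
module Submission where

open import Defs
open import Data.Nat using (ℕ)
open import Data.Product using (_×_; _,_; ∃; proj₁; proj₂)
open import Data.List using (List; map)
open import Data.List.Membership.Propositional using (_∈_)
open import Data.List.Membership.Propositional.Properties using (∈-map⁺)
open import Function.Bundles using (_⇔_; mk⇔)
open import Relation.Binary.PropositionalEquality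
  using (_≡_; refl; sym; trans; cong; module ≡-Reasoning)

cong-irr : ∀ {a b c} {A : Set a} {B : A → Set b} {C : Set c}
           (φ : (x : A) → .(B x) → C) {x y : A} →
           x ≡ y → .(p : B x) → .(q : B y) → φ x p ≡ φ y q
cong-irr φ refl _ _ = refl

constantOn-pullback :
  ∀ {o ℓ o' ℓ'} (C : Category o ℓ) (D : Category o' ℓ') {k : ℕ} →
  let module C = Category C; module D = Category D in
  ∀ {a a' b v} {α : C.Hom a a'} {c c' d w} {β : D.Hom c c'}
  (φ : Colouring C α v k) (ψ : Colouring D β w k)
  (E : C.Hom b v) (e : D.Hom d w)
  {L : List (HomFrom C α b)} {L' : List (HomFrom D β d)}
  (conv : HomFrom C α b → HomFrom D β d) →
  (∀ {u} → u ∈ L → conv u ∈ L') →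
  (∀ u → φ (E C.∘ proj₁ u) (postIm C E (proj₂ u))
       ≡ ψ (e D.∘ proj₁ (conv u)) (postIm D e (proj₂ (conv u)))) →
  ConstantOn D ψ e L' → ConstantOn C φ E L
constantOn-pullback C D φ ψ E e conv conv-∈ agree ψ-const {u} {w} u∈L w∈L =
  trans (agree u) (trans (ψ-const (conv-∈ u∈L) (conv-∈ w∈L)) (sym (agree w)))

module FullFunctor {o ℓ o' ℓ'} {S : Category o ℓ} {S' : Category o' ℓ'}
                   (F : Functor S S') (full : Full F) where
  private
    module S = Category S
    module S' = Category S'
  open Functor F

  F-InImage : ∀ {a a' b} {α : S.Hom a a'} {h : S.Hom a b} →
              InImage S α h → InImage S' (F₁ α) (F₁ h)
  F-InImage (g , h≡g∘α) = F₁ g , trans (cong F₁ h≡g∘α) F-∘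

  F-Colouring : ∀ {a a' v k} {α : S.Hom a a'} →
                Colouring S' (F₁ α) (F₀ v) k → Colouring S α v k
  F-Colouring φ h h∈ = φ (F₁ h) (F-InImage h∈)

  -- lift c (g ∘ F α) = g' ∘ α, where F g' = c ∘ g by fullness.
  lift : ∀ {a a' x y} {α : S.Hom a a'} →
         S'.Hom x (F₀ y) → HomFrom S' (F₁ α) x → HomFrom S α y
  lift {α = α} c (_ , g , _) = let g' = proj₁ (full (c S'.∘ g)) in g' S.∘ α , g' , refl

  lift-correct : ∀ {a a' x y} {α : S.Hom a a'} (c : S'.Hom x (F₀ y))
                 (u : HomFrom S' (F₁ α) x) → F₁ (proj₁ (lift c u)) ≡ c S'.∘ proj₁ u
  lift-correct {α = α} c (f , g , f≡g∘Fα) = begin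
    F₁ (g' S.∘ α)           ≡⟨ F-∘ ⟩
    F₁ g' S'.∘ F₁ α         ≡⟨ cong (S'._∘ F₁ α) (proj₂ (full (c S'.∘ g))) ⟩
    (c S'.∘ g) S'.∘ F₁ α    ≡⟨ S'.assoc ⟩
    c S'.∘ (g S'.∘ F₁ α)    ≡⟨ cong (c S'.∘_) (sym f≡g∘Fα) ⟩
    c S'.∘ f                ∎
    where
    open ≡-Reasoning
    g' = proj₁ (full (c S'.∘ g))

  F-preserves-Ramsey : Cofinal F → ∀ {a a'} (α : S.Hom a a') →
                       IsRamsey S α → IsRamsey S' (F₁ α)
  F-preserves-Ramsey cof α α-Ramsey b k L = F₀ v , witness
    where
    y = proj₁ (cof b)
    c = proj₂ (cof b)
    L' = map (lift c) L
    v = proj₁ (α-Ramsey y k L')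

    witness : (φ : Colouring S' (F₁ α) (F₀ v) k) → ∃ λ E → ConstantOn S' φ E L
    witness φ = F₁ e S'.∘ c ,
      constantOn-pullback S' S φ (F-Colouring φ) (F₁ e S'.∘ c) e (lift c) (∈-map⁺ (lift c))
        (λ u → cong-irr φ (arrow-eq u) _ _) e-const
      where
      e = proj₁ (proj₂ (α-Ramsey y k L') (F-Colouring φ))
      e-const = proj₂ (proj₂ (α-Ramsey y k L') (F-Colouring φ))

      arrow-eq : ∀ u → (F₁ e S'.∘ c) S'.∘ proj₁ u ≡ F₁ (e S.∘ proj₁ (lift c u))
      arrow-eq u = begin
        (F₁ e S'.∘ c) S'.∘ proj₁ u     ≡⟨ S'.assoc ⟩
        F₁ e S'.∘ (c S'.∘ proj₁ u)     ≡⟨ cong (F₁ e S'.∘_) (sym (lift-correct c u)) ⟩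
        F₁ e S'.∘ F₁ (proj₁ (lift c u)) ≡⟨ sym F-∘ ⟩
        F₁ (e S.∘ proj₁ (lift c u))    ∎
        where open ≡-Reasoning

open FullFunctor using (F-preserves-Ramsey)

inclusion : ∀ {o ℓ p} (S' : Category o ℓ) (P : Category.Obj S' → Set p) →
            Functor (FullSub S' P) S'
inclusion S' P = record { F₀ = proj₁ ; F₁ = λ f → f ; F-id = refl ; F-∘ = refl }

inclusion-full : ∀ {o ℓ p} (S' : Category o ℓ) (P : Category.Obj S' → Set p) →
                 Full (inclusion S' P)
inclusion-full S' P h = h , refl

inclusion-cofinal : ∀ {o ℓ p} (S' : Category o ℓ) (P : Category.Obj S' → Set p) →
                    CofinalSub S' P → Cofinal (inclusion S' P)
inclusion-cofinal S' P cof x =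
  let y , py , c = cof x in (y , py) , c

FullSub-preserves-Ramsey :
  ∀ {o ℓ p} (S' : Category o ℓ) (P : Category.Obj S' → Set p) → CofinalSub S' P →
  ∀ {a a'} (pa : P a) (pa' : P a') (α : Category.Hom S' a a') →
  IsRamsey (FullSub S' P) {a , pa} {a' , pa'} α → IsRamsey S' α
-- The objects of Full must be passed explicitly: Hom of an abstract category
-- is not injective, so they cannot be inferred from the arrow.
FullSub-preserves-Ramsey S' P cof {a} {a'} pa pa' α =
  F-preserves-Ramsey (inclusion S' P) (λ {x} {y} → inclusion-full S' P {x} {y})
    (inclusion-cofinal S' P cof) {a , pa} {a' , pa'} α

FullSub-reflects-Ramsey :
  ∀ {o ℓ p} (S' : Category o ℓ) (P : Category.Obj S' → Set p) → CofinalSub S' P →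
  ∀ {a a'} (pa : P a) (pa' : P a') (α : Category.Hom S' a a') →
  IsRamsey S' α → IsRamsey (FullSub S' P) {a , pa} {a' , pa'} α
FullSub-reflects-Ramsey S' P cof {a} {a'} pa pa' α α-Ramsey (b , pb) k L =
  (w , pw) , witness
  where
  open Category S'
  v = proj₁ (α-Ramsey b k L)
  w = proj₁ (cof v)
  pw = proj₁ (proj₂ (cof v))
  c = proj₂ (proj₂ (cof v))

  witness : (φ : Colouring (FullSub S' P) {a , pa} {a' , pa'} α (w , pw) k) →
            ∃ λ E → ConstantOn (FullSub S' P) {a , pa} {a' , pa'} {b , pb} {w , pw} φ E L
  witness φ = c ∘ e ,
    constantOn-pullback (FullSub S' P) S'
      {a = a , pa} {a' , pa'} {b , pb} {w , pw} φ ψ (c ∘ e) e (λ u → u) (λ u∈L → u∈L)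
      (λ _ → cong-irr φ assoc _ _) e-const
    where
    ψ : Colouring S' α v k
    ψ h h∈ = φ (c ∘ h) (postIm S' c h∈)
    e = proj₁ (proj₂ (α-Ramsey b k L) ψ)
    e-const = proj₂ (proj₂ (α-Ramsey b k L) ψ)

mainTheorem6 : ∀ {o ℓ o' ℓ' p} →
    (∀ (S : Category o ℓ) (S' : Category o' ℓ')
       (F : Functor S S') → Full F → Cofinal F →
       ∀ {a a'} (α : Category.Hom S a a') →
       IsRamsey S α → IsRamsey S' (Functor.F₁ F α))
    ×
    (∀ (S' : Category o' ℓ') (P : Category.Obj S' → Set p) →
       CofinalSub S' P →
       ∀ {a a'} (pa : P a) (pa' : P a') (α : Category.Hom S' a a') →
       IsRamsey (FullSub S' P) {a , pa} {a' , pa'} α ⇔ IsRamsey S' α)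
mainTheorem6 =
  (λ S S' F full cof α → F-preserves-Ramsey F full cof α) ,
  (λ S' P cof pa pa' α → mk⇔ (FullSub-preserves-Ramsey S' P cof pa pa' α)
                              (FullSub-reflects-Ramsey S' P cof pa pa' α))
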